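{- Let $k,c\ge 1$ be integers, let $T$ be the full $c$-ary rooted tree of height $k+1$ (i.e. every vertex at distance less than $k$ from the root $r$ has exactly $c$ children, and all leaves are at distance exactly $k$ from $r$), and let $G$ be the graph on vertex set $V(T)$ in which two distinct vertices are adjacent if and only if one of them is an ancestor of the other in $T$. Then $\chi_c(G)=k+1$.
   Context: In a rooted tree, $u$ is an ancestor of $v$ if $u$ lies on the path from $v$ to the root. For a graph $G$ and positive integer $c$, a $c$-clustered coloring of $G$ is a coloring of its vertices such that every monochromatic connected subgraph has at most $c$ vertices (equivalently, each color class induces a subgraph whose components have at most $c$ vertices); $\chi_c(G)$ is the minimum number of colors in a $c$-clustered coloring of $G$. (In the paper, $G$ is described as the edge-maximal graph having the $k$-tree model $(T,L)$ with labeling $L(v)=\operatorname{dist}(v,r)+1$; this is exactly the graph described in the claim.) -}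

module Defs where

open import Data.Nat using (ℕ; suc; _≤_)
open import Data.Fin using (Fin)
open import Data.List using (List; length; _++_)
open import Data.List.Membership.Propositional using (_∈_)
open import Data.List.Relation.Unary.Unique.Propositional using (Unique)
open import Data.Product using (Σ; ∃; _×_; _,_; proj₁)
open import Data.Sum using (_⊎_)
open import Relation.Binary.PropositionalEquality using (_≡_; _≢_)

-- Vertices of the full c-ary rooted tree of height k+1 (depths 0..k):
-- a vertex is the sequence of child indices on the path from the root r,
-- so the root is [] and a vertex at depth d is a list of length d ≤ k.
-- Every vertex of depth < k has exactly the c children  w ++ [i], i : Fin c,
-- and the leaves are exactly the vertices at depth k.
record Vtx (k c : ℕ) : Set where
  constructor vtx
  field
    path  : List (Fin c)
    depth : length path ≤ k
open Vtx public

Ancestor : ∀ {k c} → Vtx k c → Vtx k c → Set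
Ancestor u v = ∃ λ w → path u ++ w ≡ path v

Adj : ∀ {k c} → Vtx k c → Vtx k c → Set
Adj u v = u ≢ v × (Ancestor u v ⊎ Ancestor v u)

data Walk {k c : ℕ} (S : List (Vtx k c)) : Vtx k c → Vtx k c → Set where
  here : ∀ {x} → Walk S x x
  step : ∀ {x y z} → Adj x y → y ∈ S → Walk S y z → Walk S x z

Connected : ∀ {k c} → List (Vtx k c) → Set
Connected S = ∀ {x y} → x ∈ S → y ∈ S → Walk S x y

-- f is a b-clustered coloring with m colors: every monochromatic connected
-- subgraph has at most b vertices. (It suffices to consider induced
-- subgraphs, since a connected subgraph's vertex set induces a connected
-- subgraph with the same number of vertices.)
Clustered : ∀ {k c m} → ℕ → (Vtx k c → Fin m) → Set
Clustered {k} {c} b f =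
  (S : List (Vtx k c)) → Unique S →
  (∀ {x y} → x ∈ S → y ∈ S → f x ≡ f y) →
  Connected S → length S ≤ b

ClusteredChromaticNumberIs : (k c b n : ℕ) → Set
ClusteredChromaticNumberIs k c b n =
  (Σ (Vtx k c → Fin n) (Clustered b)) ×
  (∀ m (f : Vtx k c → Fin m) → Clustered b f → n ≤ m)

{-# OPTIONS --safe #-}
-- Colouring each vertex by its depth uses k + 1 colours, and no two vertices
-- of equal depth are comparable, so every colour class is independent.
-- Conversely, walk down from the root: if every child subtree of v contained
-- a vertex of v's colour, those c vertices together with v would form a
-- monochromatic connected star of size c + 1. So some child subtree avoids
-- the colour of v, and also every colour met on the way down; after k steps
-- we have seen k + 1 distinct colours. Choosing that child is not
-- constructive, so the bound is obtained double-negated and then recovered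
-- by decidability of ≤.
module Submission where

open import Defs
open import Data.Nat using (ℕ; zero; suc; _+_; _≤_; _<_; z≤n; s≤s; _≤?_)
open import Data.Nat.Properties
  using (≤-refl; ≤-trans; ≤-reflexive; <-≤-trans; +-comm; +-suc; +-identityʳ;
         m<m+n; m≤m+n; <-irrefl; m+1+n≢m; 1+n≰n; ≤-irrelevant)
open import Data.Fin using (Fin; zero; suc; fromℕ<)
open import Data.Fin.Properties using (fromℕ<-injective; injective⇒≤)
open import Data.List using (List; []; _∷_; length; _++_; [_]; lookup; tabulate)
open import Data.List.Properties
  using (length-++; ++-assoc; ++-identityʳ; ++-cancelˡ; ∷-injectiveˡ; length-tabulate)
open import Data.List.Membership.Propositional using (_∈_; _∉_)
open import Data.List.Membership.Propositional.Properties
  using (∈-lookup; ∈-tabulate⁻)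
open import Data.List.Relation.Unary.Any using (here; there)
open import Data.List.Relation.Unary.All as All using (_∷_)
open import Data.List.Relation.Unary.All.Properties using (¬Any⇒All¬; tabulate⁺)
open import Data.List.Relation.Unary.AllPairs using ([]; _∷_)
open import Data.List.Relation.Unary.Unique.Propositional using (Unique)
import Data.List.Relation.Unary.Unique.Propositional.Properties as Unique
open import Data.Product using (Σ; ∃; _×_; _,_; proj₁; proj₂)
open import Data.Sum using (inj₁; inj₂)
open import Data.Empty using (⊥; ⊥-elim)
open import Function using (_∘_; Injective)
open import Relation.Nullary using (¬_)
open import Relation.Nullary.Decidable using (decidable-stable)
open import Relation.Binary.PropositionalEquality
  using (_≡_; _≢_; refl; sym; trans; cong; subst)

lookup-injective : ∀ {A : Set} {xs : List A} → Unique xs → Injective _≡_ _≡_ (lookup xs)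
lookup-injective {xs = _ ∷ _} (_ ∷ _) {zero} {zero} _ = refl
lookup-injective {xs = _ ∷ _} (x∉ ∷ _) {zero} {suc j} e = ⊥-elim (All.lookup x∉ (∈-lookup j) e)
lookup-injective {xs = _ ∷ _} (x∉ ∷ _) {suc i} {zero} e = ⊥-elim (All.lookup x∉ (∈-lookup i) (sym e))
lookup-injective {xs = _ ∷ _} (_ ∷ u) {suc i} {suc j} e = cong suc (lookup-injective u e)

Unique⇒length≤ : ∀ {m} {xs : List (Fin m)} → Unique xs → length xs ≤ m
Unique⇒length≤ u = injective⇒≤ (lookup-injective u)

Unique∧constant⇒length≤1 : ∀ {A : Set} {xs : List A} → Unique xs →
                           (∀ {x y} → x ∈ xs → y ∈ xs → x ≡ y) → length xs ≤ 1
Unique∧constant⇒length≤1 {xs = []} _ _ = z≤n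
Unique∧constant⇒length≤1 {xs = _ ∷ []} _ _ = ≤-refl
Unique∧constant⇒length≤1 {xs = _ ∷ _ ∷ _} ((x≢y ∷ _) ∷ _) constant =
  ⊥-elim (x≢y (constant (here refl) (there (here refl))))

length-∷ʳ : ∀ {A : Set} (xs : List A) x → length (xs ++ [ x ]) ≡ suc (length xs)
length-∷ʳ xs x = trans (length-++ xs) (+-comm (length xs) 1)

¬¬-∀-Fin : ∀ {n} {P : Fin n → Set} → (∀ i → ¬ ¬ P i) → ¬ ¬ (∀ i → P i)
¬¬-∀-Fin {zero} _ ¬all = ¬all λ ()
¬¬-∀-Fin {suc n} {P} ¬¬P ¬all =
  ¬¬P zero λ P0 → ¬¬-∀-Fin (¬¬P ∘ suc) λ Psuc → ¬all λ { zero → P0 ; (suc i) → Psuc i }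

module _ {k c : ℕ} where

  level : Vtx k c → ℕ
  level = length ∘ path

  Vtx-≡ : {u v : Vtx k c} → path u ≡ path v → u ≡ v
  Vtx-≡ {vtx p d} {vtx .p e} refl = cong (vtx p) (≤-irrelevant d e)

  Ancestor∧same-level⇒≡ : {u v : Vtx k c} → Ancestor u v → level u ≡ level v → u ≡ v
  Ancestor∧same-level⇒≡ {u} ([] , e) _ = Vtx-≡ (trans (sym (++-identityʳ (path u))) e)
  Ancestor∧same-level⇒≡ {u} (_ ∷ _ , refl) same =
    ⊥-elim (m+1+n≢m (level u) (sym (trans same (length-++ (path u)))))

  Adj⇒level≢ : {u v : Vtx k c} → Adj u v → level u ≢ level v
  Adj⇒level≢ (u≢v , inj₁ u≼v) same = u≢v (Ancestor∧same-level⇒≡ u≼v same)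
  Adj⇒level≢ (u≢v , inj₂ v≼u) same = u≢v (sym (Ancestor∧same-level⇒≡ v≼u (sym same)))

  Adj-sym : {u v : Vtx k c} → Adj u v → Adj v u
  Adj-sym (u≢v , inj₁ u≼v) = u≢v ∘ sym , inj₂ u≼v
  Adj-sym (u≢v , inj₂ v≼u) = u≢v ∘ sym , inj₁ v≼u

  _◅◅_ : {S : List (Vtx k c)} {x y z : Vtx k c} → Walk S x y → Walk S y z → Walk S x z
  here ◅◅ w = w
  step xy y∈S w₁ ◅◅ w₂ = step xy y∈S (w₁ ◅◅ w₂)

  star-Connected : {v : Vtx k c} {xs : List (Vtx k c)} →
                   (∀ {x} → x ∈ xs → Adj v x) → Connected (v ∷ xs)
  star-Connected {v} {xs} adj x∈ y∈ = toCentre x∈ ◅◅ fromCentre y∈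
    where
    toCentre : ∀ {x} → x ∈ v ∷ xs → Walk (v ∷ xs) x v
    toCentre (here refl) = here
    toCentre (there x∈xs) = step (Adj-sym (adj x∈xs)) (here refl) here
    fromCentre : ∀ {y} → y ∈ v ∷ xs → Walk (v ∷ xs) v y
    fromCentre (here refl) = here
    fromCentre (there y∈xs) = step (adj y∈xs) (there y∈xs) here

  proper⇒clustered : ∀ {m b} {f : Vtx k c → Fin m} →
                     (∀ {x y} → f x ≡ f y → ¬ Adj x y) → 1 ≤ b → Clustered b f
  proper⇒clustered proper 1≤b S S-unique monochromatic connected =
    ≤-trans (Unique∧constant⇒length≤1 S-unique constant) 1≤b
    where
    constant : ∀ {x y} → x ∈ S → y ∈ S → x ≡ y
    constant x∈ y∈ with connected x∈ y∈
    ... | here = refl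
    ... | step xz z∈ _ = ⊥-elim (proper (monochromatic x∈ z∈) xz)

  levelColouring : Vtx k c → Fin (suc k)
  levelColouring v = fromℕ< (s≤s (depth v))

  levelColouring-proper : ∀ {x y} → levelColouring x ≡ levelColouring y → ¬ Adj x y
  levelColouring-proper {x} {y} e xy =
    Adj⇒level≢ xy (fromℕ<-injective (level x) (level y) (s≤s (depth x)) (s≤s (depth y)) e)

  record InSubtree (p : List (Fin c)) (w : Vtx k c) : Set where
    constructor below
    field
      suffix : List (Fin c)
      path≡  : p ++ suffix ≡ path w

  InSubtree-refl : (v : Vtx k c) → InSubtree (path v) v
  InSubtree-refl v = below [] (++-identityʳ (path v))

  InSubtree⇒Ancestor : ∀ {v w} → InSubtree (path v) w → Ancestor v w
  InSubtree⇒Ancestor (below q e) = q , e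

  InSubtree-parent : ∀ {p i w} → InSubtree (p ++ [ i ]) w → InSubtree p w
  InSubtree-parent {p} {i} (below q e) = below (i ∷ q) (trans (sym (++-assoc p [ i ] q)) e)

  InSubtree-child-unique : ∀ {p i j w} → InSubtree (p ++ [ i ]) w → InSubtree (p ++ [ j ]) w → i ≡ j
  InSubtree-child-unique {p} {i} {j} (below q e) (below r e′) =
    ∷-injectiveˡ (++-cancelˡ p (i ∷ q) (j ∷ r)
      (trans (sym (++-assoc p [ i ] q)) (trans e (trans (sym e′) (++-assoc p [ j ] r)))))

  InSubtree⇒length≤level : ∀ {p w} → InSubtree p w → length p ≤ level w
  InSubtree⇒length≤level {p} (below q refl) =
    ≤-trans (m≤m+n (length p) (length q)) (≤-reflexive (sym (length-++ p)))

  InSubtree-child⇒Adj : ∀ {v i w} → InSubtree (path v ++ [ i ]) w → Adj v w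
  InSubtree-child⇒Adj {v} {i} {w} w∈ = v≢w , inj₁ (InSubtree⇒Ancestor {v} (InSubtree-parent w∈))
    where
    v<w : level v < level w
    v<w = ≤-trans (≤-reflexive (sym (length-∷ʳ (path v) i))) (InSubtree⇒length≤level w∈)
    v≢w : v ≢ w
    v≢w v≡w = <-irrefl (cong level v≡w) v<w

  child : (v : Vtx k c) → level v < k → Fin c → Vtx k c
  child v v<k i = vtx (path v ++ [ i ]) (subst (_≤ k) (sym (length-∷ʳ (path v) i)) v<k)

  module LowerBound {m : ℕ} (f : Vtx k c → Fin m) (clustered : Clustered c f) where

    no-monochromatic-star : (v : Vtx k c) (w : Fin c → Vtx k c) →
                            (∀ i → InSubtree (path v ++ [ i ]) (w i)) →
                            (∀ i → f (w i) ≡ f v) → ⊥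
    no-monochromatic-star v w w∈ w-colour =
      1+n≰n (subst (λ n → suc n ≤ c) (length-tabulate w)
               (clustered S S-unique monochromatic (star-Connected adjacent)))
      where
      S = v ∷ tabulate w
      adjacent : ∀ {x} → x ∈ tabulate w → Adj v x
      adjacent x∈ with ∈-tabulate⁻ x∈
      ... | i , refl = InSubtree-child⇒Adj {i = i} (w∈ i)
      S-unique : Unique S
      S-unique = tabulate⁺ (λ i → proj₁ (InSubtree-child⇒Adj {i = i} (w∈ i)))
               ∷ Unique.tabulate⁺ (λ {i} {j} e →
                   InSubtree-child-unique (w∈ i) (subst (InSubtree _) (sym e) (w∈ j)))
      colour≡ : ∀ {x} → x ∈ S → f x ≡ f v
      colour≡ (here refl) = refl
      colour≡ (there x∈) with ∈-tabulate⁻ x∈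
      ... | i , refl = w-colour i
      monochromatic : ∀ {x y} → x ∈ S → y ∈ S → f x ≡ f y
      monochromatic x∈ y∈ = trans (colour≡ x∈) (sym (colour≡ y∈))

    AvoidsBelow : List (Fin m) → List (Fin c) → Set
    AvoidsBelow Fs p = ∀ w → InSubtree p w → f w ∉ Fs

    some-child-avoids-colour : (v : Vtx k c) →
                               ¬ ¬ (∃ λ i → AvoidsBelow [ f v ] (path v ++ [ i ]))
    some-child-avoids-colour v ¬some =
      ¬¬-∀-Fin (λ i ¬hit → ¬some (i , λ w w∈ → λ { (here e) → ¬hit (w , w∈ , e) })) star
      where
      star : (∀ i → Σ (Vtx k c) λ w → InSubtree (path v ++ [ i ]) w × f w ≡ f v) → ⊥
      star hit = no-monochromatic-star v (proj₁ ∘ hit) (proj₁ ∘ proj₂ ∘ hit) (proj₂ ∘ proj₂ ∘ hit)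

    -- Fs holds the colours met on the path down to v; h is the depth still available below v.
    colours-below : ∀ h (v : Vtx k c) → level v + h ≤ k → ∀ {Fs} → Unique Fs →
                    AvoidsBelow Fs (path v) → ¬ ¬ (suc (length Fs + h) ≤ m)
    colours-below zero v _ {Fs} Fs-unique avoids ¬bound =
      ¬bound (subst (λ n → suc n ≤ m) (sym (+-identityʳ (length Fs)))
                (Unique⇒length≤ (¬Any⇒All¬ Fs (avoids v (InSubtree-refl v)) ∷ Fs-unique)))
    colours-below (suc h) v v+h<k {Fs} Fs-unique avoids ¬bound =
      some-child-avoids-colour v λ (i , i-avoids) →
        colours-below h (child v v<k i) (child-fits i)
          (¬Any⇒All¬ Fs (avoids v (InSubtree-refl v)) ∷ Fs-unique) (extend i i-avoids)
          (¬bound ∘ subst (λ n → suc n ≤ m) (sym (+-suc (length Fs) h)))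
      where
      v<k : level v < k
      v<k = <-≤-trans (m<m+n (level v) (s≤s z≤n)) v+h<k
      child-fits : ∀ i → level (child v v<k i) + h ≤ k
      child-fits i = ≤-trans (≤-reflexive (trans (cong (_+ h) (length-∷ʳ (path v) i))
                                                 (sym (+-suc (level v) h))))
                             v+h<k
      extend : ∀ i → AvoidsBelow [ f v ] (path v ++ [ i ]) →
               AvoidsBelow (f v ∷ Fs) (path v ++ [ i ])
      extend i i-avoids w w∈ (here e) = i-avoids w w∈ (here e)
      extend i _ w w∈ (there e) = avoids w (InSubtree-parent w∈) e

mainTheorem2 : (k c : ℕ) → 1 ≤ k → 1 ≤ c → ClusteredChromaticNumberIs k c c (suc k)
mainTheorem2 k c _ 1≤c =
  (levelColouring , proper⇒clustered levelColouring-proper 1≤c) ,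
  λ m f clustered →
    decidable-stable (suc k ≤? m)
      (LowerBound.colours-below f clustered k root ≤-refl [] λ _ _ ())
  where
  root : Vtx k c
  root = vtx [] z≤n
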